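{- Let $n\ge 1$ and let $P$ be the path with vertices $1,2,\ldots,n+1$ in order, with edges $f_j=\{j,j+1\}$ for $j=1,\ldots,n$, each regarded as the transposition $(j,j+1)$. Consider an ordering $f_{a_1},f_{a_2},\ldots,f_{a_n}$ of the edges (so $[a_1,\ldots,a_n]$ is a permutation of $\{1,\ldots,n\}$), and let $\pi(j)$ denote the position of $f_j$ in this ordering (so $\pi(a_k)=k$). Then the product $f_{a_1}f_{a_2}\cdots f_{a_n}$ equals the cyclic permutation $$(1,3,5,\ldots,6,4,2),$$ which lists the odd elements of $\{1,\ldots,n+1\}$ in increasing order followed by the even elements of $\{1,\ldots,n+1\}$ in decreasing order, if and only if $\pi(1)<\pi(2)>\pi(3)<\pi(4)>\cdots$ (i.e. $\pi$ is an up-down permutation in passive form; equivalently, the ordering is the inverse of an up-down permutation).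
   Context: Permutations act on the right and products are composed left to right: $x(gh)=(xg)h$, so in $f_{a_1}\cdots f_{a_n}$ the transposition $f_{a_1}$ is applied first. A permutation with passive form $[b_1,\ldots,b_n]$ is up-down if $b_1<b_2>b_3<b_4>\cdots$. -}

module Defs where

open import Data.Nat using (ℕ; zero; suc; _+_; _∸_; _<_; _≤_; _>_)
open import Data.Nat.Properties using (_≤?_)
open import Data.Bool using (Bool; true; false; if_then_else_)
open import Data.Fin using (Fin; toℕ; inject₁) renaming (suc to fsuc)
open import Data.Fin.Permutation using (Permutation′; transpose; _⟨$⟩ʳ_; _⟨$⟩ˡ_)
open import Data.List using (List; foldl; map; allFin)
open import Relation.Nullary.Decidable using (⌊_⌋)
open import Relation.Binary.PropositionalEquality using (_≡_)

-- Convention: 0-indexed. Vertex v ∈ {1,…,n+1} of the paper is  Fin (suc n)  element v-1;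
-- edge f_j (j ∈ {1,…,n}) is  Fin n  element j-1, acting as the transposition
-- of the vertices j-1 and j (0-indexed), i.e. (j, j+1) in the paper.
edge : {n : ℕ} → Fin n → Permutation′ (suc n)
edge j = transpose (inject₁ j) (fsuc j)

-- An ordering of the edges: a ⟨$⟩ʳ k = index of the edge in position k (k 0-indexed),
-- i.e. a_{k+1} in the paper.  π j = a ⟨$⟩ˡ j is the position of edge j.

-- Action of the product f_{a_1} f_{a_2} ⋯ f_{a_n} on a vertex (right action,
-- f_{a_1} applied first).
product : {n : ℕ} → Permutation′ n → Fin (suc n) → Fin (suc n)
product {n} a x = foldl (λ y k → edge (a ⟨$⟩ʳ k) ⟨$⟩ʳ y) x (allFin n)

even : ℕ → Bool
even zero = true
even (suc m) = odd m
  where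
  odd : ℕ → Bool
  odd zero = false
  odd (suc k) = even k

-- The cycle (1,3,5,…,6,4,2) on {1,…,N}, in the paper's 1-indexed vertex labels:
-- odd v with v+2 ≤ N ↦ v+2; the largest odd ↦ the largest even ≤ N;
-- even v > 2 ↦ v-2; 2 ↦ 1.
largestEven : ℕ → ℕ
largestEven N = if even N then N else N ∸ 1

cyc : ℕ → ℕ → ℕ
cyc N v =
  if even v
  then (if ⌊ v ≤? 2 ⌋ then 1 else v ∸ 2)
  else (if ⌊ v + 2 ≤? N ⌋ then v + 2 else largestEven N)

IsOddEvenCycle : (n : ℕ) → (Fin (suc n) → Fin (suc n)) → Set
IsOddEvenCycle n σ = (x : Fin (suc n)) → suc (toℕ (σ x)) ≡ cyc (suc n) (suc (toℕ x))

-- Up-down in passive form: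
-- π(1) < π(2) > π(3) < ⋯ ; in 0-indexed edges: for consecutive edges i, i+1,
-- π i < π (i+1) if i is even (paper index i+1 odd), and π i > π (i+1) otherwise.
UpDown : {n : ℕ} → (Fin n → Fin n) → Set
UpDown {n} π = (i : Fin n) (j : Fin n) → toℕ j ≡ suc (toℕ i) →
  (if even (toℕ i) then toℕ (π i) < toℕ (π j) else toℕ (π i) > toℕ (π j))

-- Follow the token that starts on a vertex while the transpositions are applied. Edge e
-- is applied at time π e, so a token on v can move only at the times π (v-1) and π v at
-- which the two edges at v are applied. Under the up-down condition a token on an odd
-- vertex v of the paper is first met by the edge on its right, then by the next edge on
-- the right, and the edges at v+2 have then both been applied: it ends on v+2.
-- Symmetrically tokens on even vertices end two steps to the left, and the two ends of
-- the path give the turnarounds of (1,3,5,…,6,4,2). Conversely a token cannot jump an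
-- edge, so it can get from v to v+2 (or from v+2 to v) only by crossing the two edges
-- between them in that order; the cycle therefore forces every ascent and descent of π.

module Submission where

open import Defs
open import Data.Nat using (ℕ; zero; suc; _+_; _<_; _≤_; _>_; _≥_; z≤n; s≤s; _≤′_; ≤′-reflexive; ≤′-step)
open import Data.Nat.Properties
  using ( _≟_; _<?_; _≤?_; ≤-refl; ≤-reflexive; ≤-trans; ≤-antisym; ≤-pred; <-trans; <-≤-trans
        ; <⇒≤; <⇒≱; ≤∧≢⇒<; ≮⇒≥; ≰⇒>; <-irrefl; <-cmp; <-≤-connex; n≤1+n; n<1+n; m<n⇒m<1+n
        ; m+1+n≰m; ≤⇒≤′; ≤′⇒≤; +-comm; suc-injective)
open import Data.Bool using (Bool; true; false; if_then_else_; not)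
open import Data.Bool.Properties using (not-involutive; not-injective)
open import Data.Fin using (Fin; toℕ; fromℕ<; inject₁) renaming (zero to fzero; suc to fsuc)
open import Data.Fin.Properties using (toℕ-fromℕ<; fromℕ<-toℕ; toℕ<n; toℕ-inject₁; toℕ-injective) renaming (_≟_ to _≟ᶠ_)
open import Data.Fin.Permutation using (Permutation′; flip; _⟨$⟩ʳ_; _⟨$⟩ˡ_; inverseˡ)
open import Data.List using (foldl; tabulate)
open import Data.Sum using (_⊎_; inj₁; inj₂)
open import Data.Unit using (⊤; tt)
open import Function using (_∘_; id)
open import Function.Bundles using (_⇔_; mk⇔)
import Function.Properties.Equivalence as ⇔
open import Relation.Binary using (tri<; tri≈; tri>)
open import Relation.Binary.PropositionalEquality
open import Relation.Nullary using (Dec; yes; no; ¬_; contradiction)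
open import Relation.Nullary.Decidable using (⌊_⌋)

swap : ℕ → ℕ → ℕ
swap e y with y ≟ e
... | yes _ = suc e
... | no _ with y ≟ suc e
...   | yes _ = e
...   | no _ = y

data SwapView (e : ℕ) : ℕ → ℕ → Set where
  at-left  : SwapView e e (suc e)
  at-right : SwapView e (suc e) e
  away     : ∀ {y} → y ≢ e → y ≢ suc e → SwapView e y y

swap-view : ∀ e y → SwapView e y (swap e y)
swap-view e y with y ≟ e
... | yes refl = at-left
... | no y≢e with y ≟ suc e
...   | yes refl = at-right
...   | no y≢e+1 = away y≢e y≢e+1

swap-left : ∀ e → swap e e ≡ suc e
swap-left e with swap e e | swap-view e e
... | _ | at-left = refl
... | _ | away e≢e _ = contradiction refl e≢e

swap-right : ∀ e → swap e (suc e) ≡ e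
swap-right e with swap e (suc e) | swap-view e (suc e)
... | _ | at-right = refl
... | _ | away _ e+1≢e+1 = contradiction refl e+1≢e+1

swap-away : ∀ {e y} → y ≢ e → y ≢ suc e → swap e y ≡ y
swap-away {e} {y} y≢e y≢e+1 with swap e y | swap-view e y
... | _ | at-left = contradiction refl y≢e
... | _ | at-right = contradiction refl y≢e+1
... | _ | away _ _ = refl

swap-≤ : ∀ {e y b} → e ≢ b → y ≤ b → swap e y ≤ b
swap-≤ {e} {y} e≢b y≤b with swap e y | swap-view e y
... | _ | at-left = ≤∧≢⇒< y≤b e≢b
... | _ | at-right = <⇒≤ y≤b
... | _ | away _ _ = y≤b

<-swap : ∀ {e y b} → e ≢ b → b < y → b < swap e y
<-swap {e} {y} e≢b b<y with swap e y | swap-view e y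
... | _ | at-left = ≤-trans b<y (n≤1+n e)
... | _ | at-right = ≤∧≢⇒< (≤-pred b<y) (e≢b ∘ sym)
... | _ | away _ _ = b<y

swap-≤-suc : ∀ e y → swap e y ≤ suc y
swap-≤-suc e y with swap e y | swap-view e y
... | _ | at-left = ≤-refl
... | _ | at-right = ≤-trans (n≤1+n e) (n≤1+n (suc e))
... | _ | away _ _ = n≤1+n y

≤-suc-swap : ∀ e y → y ≤ suc (swap e y)
≤-suc-swap e y with swap e y | swap-view e y
... | _ | at-left = ≤-trans (n≤1+n e) (n≤1+n (suc e))
... | _ | at-right = ≤-refl
... | _ | away _ _ = n≤1+n y

toℕ-edge : ∀ {n} (j : Fin n) (y : Fin (suc n)) → toℕ (edge j ⟨$⟩ʳ y) ≡ swap (toℕ j) (toℕ y)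
toℕ-edge j y with y ≟ᶠ inject₁ j
... | yes refl = sym (trans (cong (swap (toℕ j)) (toℕ-inject₁ j)) (swap-left (toℕ j)))
... | no y≢j with y ≟ᶠ fsuc j
...   | yes refl = trans (toℕ-inject₁ j) (sym (swap-right (toℕ j)))
...   | no y≢j+1 = sym (swap-away (y≢j ∘ λ eq → toℕ-injective (trans eq (sym (toℕ-inject₁ j))))
                                  (y≢j+1 ∘ toℕ-injective))

walk : (ℕ → ℕ) → ℕ → ℕ → ℕ
walk s x zero = x
walk s x (suc t) = swap (s t) (walk s x t)

walk-suc : ∀ s x t → walk s x (suc t) ≡ walk (s ∘ suc) (swap (s 0) x) t
walk-suc s x zero = refl
walk-suc s x (suc t) = cong (swap (s (suc t))) (walk-suc s x t)

walk-preserves : ∀ (P : ℕ → Set) {s x t t'} → t ≤ t' →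
  (∀ k → t ≤ k → k < t' → ∀ {y} → P y → P (swap (s k) y)) →
  P (walk s x t) → P (walk s x t')
walk-preserves P {s} {x} {t} {t'} t≤t' step p = go (≤⇒≤′ t≤t') ≤-refl
  where
  go : ∀ {u} → t ≤′ u → u ≤ t' → P (walk s x u)
  go (≤′-reflexive refl) _ = p
  go (≤′-step {m} t≤′m) m<t' = step m (≤′⇒≤ t≤′m) m<t' (go t≤′m (<⇒≤ m<t'))

toℕ-foldl-edges : ∀ {A : Set} {m n} (h : A → Fin n) (g : Fin m → A) (s : ℕ → ℕ) →
  (∀ i → s (toℕ i) ≡ toℕ (h (g i))) → ∀ x →
  toℕ (foldl (λ y k → edge (h k) ⟨$⟩ʳ y) x (tabulate g)) ≡ walk s (toℕ x) m
toℕ-foldl-edges {m = zero} h g s hs x = refl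
toℕ-foldl-edges {m = suc m} h g s hs x = begin
  toℕ (foldl _ (edge (h (g fzero)) ⟨$⟩ʳ x) (tabulate (g ∘ fsuc)))
    ≡⟨ toℕ-foldl-edges h (g ∘ fsuc) (s ∘ suc) (hs ∘ fsuc) _ ⟩
  walk (s ∘ suc) (toℕ (edge (h (g fzero)) ⟨$⟩ʳ x)) m
    ≡⟨ cong (λ y → walk (s ∘ suc) y m) (trans (toℕ-edge _ x) (cong (λ e → swap e (toℕ x)) (sym (hs fzero)))) ⟩
  walk (s ∘ suc) (swap (s 0) (toℕ x)) m
    ≡⟨ walk-suc s (toℕ x) m ⟨
  walk s (toℕ x) (suc m) ∎
  where open ≡-Reasoning

extend : ∀ {n} → Permutation′ n → ℕ → ℕ
extend {n} σ k with k <? n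
... | yes k<n = toℕ (σ ⟨$⟩ʳ fromℕ< k<n)
... | no _ = k

extend-toℕ : ∀ {n} (σ : Permutation′ n) i → extend σ (toℕ i) ≡ toℕ (σ ⟨$⟩ʳ i)
extend-toℕ {n} σ i with toℕ i <? n
... | yes i<n = cong (toℕ ∘ (σ ⟨$⟩ʳ_)) (fromℕ<-toℕ i i<n)
... | no i≮n = contradiction (toℕ<n i) i≮n

extend-≥ : ∀ {n} (σ : Permutation′ n) {k} → n ≤ k → extend σ k ≡ k
extend-≥ {n} σ {k} n≤k with k <? n
... | yes k<n = contradiction (<-≤-trans k<n n≤k) (<-irrefl refl)
... | no _ = refl

extend-< : ∀ {n} (σ : Permutation′ n) {k} → k < n → extend σ k < n
extend-< {n} σ {k} k<n with k <? n
... | yes _ = toℕ<n _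
... | no k≮n = contradiction k<n k≮n

extend-inverse : ∀ {n} (σ : Permutation′ n) k → extend (flip σ) (extend σ k) ≡ k
extend-inverse {n} σ k with k <? n
... | yes k<n = trans (extend-toℕ (flip σ) _) (trans (cong toℕ (inverseˡ σ)) (toℕ-fromℕ< k<n))
... | no k≮n = extend-≥ (flip σ) (≮⇒≥ k≮n)

even-suc : ∀ m → even (suc m) ≡ not (even m)
even-suc zero = refl
even-suc (suc m) = trans (sym (not-involutive (even m))) (cong not (sym (even-suc m)))

even⇒odd-suc : ∀ {m} → even m ≡ true → even (suc m) ≡ false
even⇒odd-suc {m} ev = trans (even-suc m) (cong not ev)

even-suc⇒odd : ∀ {m} → even (suc m) ≡ true → even m ≡ false
even-suc⇒odd {m} ev = not-injective (trans (sym (even-suc m)) ev)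

odd-suc⇒even : ∀ {m} → even (suc m) ≡ false → even m ≡ true
odd-suc⇒even {m} ev = not-injective (trans (sym (even-suc m)) ev)

if-true : ∀ {A : Set} {b} {x y : A} → b ≡ true → (if b then x else y) ≡ x
if-true refl = refl

if-false : ∀ {A : Set} {b} {x y : A} → b ≡ false → (if b then x else y) ≡ y
if-false refl = refl

if-yes : ∀ {A B : Set} (d : Dec A) {x y : B} → A → (if ⌊ d ⌋ then x else y) ≡ x
if-yes (yes _) _ = refl
if-yes (no ¬a) a = contradiction a ¬a

if-no : ∀ {A B : Set} (d : Dec A) {x y : B} → ¬ A → (if ⌊ d ⌋ then x else y) ≡ y
if-no (yes a) ¬a = contradiction a ¬a
if-no (no _) _ = refl

-- Vertices are 0-indexed here while cyc takes the paper's labels: the image of v is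
-- read off from cyc m (suc v), so an even v is an odd vertex of the paper.
cyc-even-up : ∀ {m v} → even v ≡ true → suc v < m → cyc (suc m) (suc v) ≡ suc (suc (suc v))
cyc-even-up {m} {v} ev v+1<m = begin
  cyc (suc m) (suc v)
    ≡⟨ if-false (even⇒odd-suc {v} ev) ⟩
  (if ⌊ suc v + 2 ≤? suc m ⌋ then suc v + 2 else largestEven (suc m))
    ≡⟨ if-yes (suc v + 2 ≤? suc m) (s≤s (subst (_≤ m) (+-comm 2 v) v+1<m)) ⟩
  suc v + 2
    ≡⟨ cong suc (+-comm v 2) ⟩
  suc (suc (suc v)) ∎
  where open ≡-Reasoning

cyc-even-last : ∀ {m v} → even v ≡ true → suc v ≡ m → cyc (suc m) (suc v) ≡ suc (suc v)
cyc-even-last {v = v} ev refl = begin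
  cyc (suc (suc v)) (suc v)
    ≡⟨ if-false (even⇒odd-suc {v} ev) ⟩
  (if ⌊ suc v + 2 ≤? suc (suc v) ⌋ then suc v + 2 else largestEven (suc (suc v)))
    ≡⟨ if-no (suc v + 2 ≤? suc (suc v)) (λ v+3≤v+2 → <-irrefl refl (subst (_≤ suc (suc v)) (cong suc (+-comm v 2)) v+3≤v+2)) ⟩
  largestEven (suc (suc v))
    ≡⟨ if-true ev ⟩
  suc (suc v) ∎
  where open ≡-Reasoning

cyc-even-top : ∀ {m u} → even u ≡ false → suc u ≡ m → cyc (suc m) (suc (suc u)) ≡ suc u
cyc-even-top {u = u} ev refl = begin
  cyc (suc (suc u)) (suc (suc u))
    ≡⟨ if-false ev ⟩
  (if ⌊ suc (suc u) + 2 ≤? suc (suc u) ⌋ then suc (suc u) + 2 else largestEven (suc (suc u)))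
    ≡⟨ if-no (suc (suc u) + 2 ≤? suc (suc u)) (λ u+4≤u+2 → m+1+n≰m (suc (suc u)) {1} u+4≤u+2) ⟩
  largestEven (suc (suc u))
    ≡⟨ if-false ev ⟩
  suc u ∎
  where open ≡-Reasoning

cyc-odd-down : ∀ {m z} → even z ≡ true → cyc m (suc (suc (suc (suc z)))) ≡ suc (suc z)
cyc-odd-down = if-true

Alternates : Bool → ℕ → ℕ → Set
Alternates b x y = if b then x < y else x > y

module Schedule {n : ℕ} (σ : Permutation′ n) where

  -- s k is the edge applied at time k and π e the time at which edge e is applied.
  -- Extended to ℕ, every edge e ≥ n (such as the missing edge n right of the last
  -- vertex) is applied only at time e, i.e. never among the first n steps.

  s π : ℕ → ℕ
  s = extend σ
  π = extend (flip σ)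

  π-s : ∀ k → π (s k) ≡ k
  π-s = extend-inverse σ

  s-π : ∀ e → s (π e) ≡ e
  s-π = extend-inverse (flip σ)

  π-< : ∀ {e} → e < n → π e < n
  π-< = extend-< (flip σ)

  π-≥ : ∀ {e} → n ≤ e → π e ≡ e
  π-≥ = extend-≥ (flip σ)

  π-ascent-≥ : ∀ {e} → n ≤ suc e → π e < π (suc e)
  π-ascent-≥ {e} n≤e+1 with n ≤? e
  ... | yes n≤e = subst₂ _<_ (sym (π-≥ n≤e)) (sym (π-≥ n≤e+1)) (n<1+n e)
  ... | no n≰e = <-≤-trans (π-< (≰⇒> n≰e)) (subst (n ≤_) (sym (π-≥ n≤e+1)) n≤e+1)

  position : ℕ → ℕ → ℕ
  position = walk s

  Idle : ℕ → ℕ → ℕ → Set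
  Idle e t t' = π e < t ⊎ t' ≤ π e

  IdleLeft : ℕ → ℕ → ℕ → Set
  IdleLeft zero t t' = ⊤
  IdleLeft (suc u) t t' = Idle u t t'

  idle-unused : ∀ {e t t' k} → Idle e t t' → t ≤ k → k < t' → s k ≢ e
  idle-unused {t = t} {t'} {k} idle t≤k k<t' refl with subst (λ j → j < t ⊎ t' ≤ j) (π-s k) idle
  ... | inj₁ k<t = <⇒≱ k<t t≤k
  ... | inj₂ t'≤k = <⇒≱ k<t' t'≤k

  idle-beyond : ∀ {e t t'} → n ≤ e → t' ≤ n → Idle e t t'
  idle-beyond n≤e t'≤n = inj₂ (subst (_ ≤_) (sym (π-≥ n≤e)) (≤-trans t'≤n n≤e))

  stays : ∀ {x v t t'} → t ≤ t' → Idle v t t' → IdleLeft v t t' → position x t ≡ v → position x t' ≡ v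
  stays {v = v} t≤t' idle idleLeft = walk-preserves (_≡ v) t≤t' λ k t≤k k<t' {y} y≡v →
    trans (swap-away (λ y≡sk → idle-unused idle t≤k k<t' (trans (sym y≡sk) y≡v))
                     (λ y≡sk+1 → left-unused v idleLeft t≤k k<t' (trans (sym y≡sk+1) y≡v)))
          y≡v
    where
    left-unused : ∀ v {t t' k} → IdleLeft v t t' → t ≤ k → k < t' → suc (s k) ≢ v
    left-unused zero _ _ _ ()
    left-unused (suc u) idle t≤k k<t' = idle-unused idle t≤k k<t' ∘ suc-injective

  stays-≤ : ∀ {x b t t'} → t ≤ t' → Idle b t t' → position x t ≤ b → position x t' ≤ b
  stays-≤ {b = b} t≤t' idle = walk-preserves (_≤ b) t≤t' λ k t≤k k<t' → swap-≤ (idle-unused idle t≤k k<t')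

  stays-> : ∀ {x b t t'} → t ≤ t' → Idle b t t' → b < position x t → b < position x t'
  stays-> {b = b} t≤t' idle = walk-preserves (b <_) t≤t' λ k t≤k k<t' → <-swap (idle-unused idle t≤k k<t')

  crosses-right : ∀ {x e t} → t ≤ π e → IdleLeft e t (π e) → position x t ≡ e → position x (suc (π e)) ≡ suc e
  crosses-right {e = e} t≤πe idleLeft at-e =
    trans (cong₂ swap (s-π e) (stays t≤πe (inj₂ ≤-refl) idleLeft at-e)) (swap-left e)

  crosses-left : ∀ {x e t} → t ≤ π e → Idle (suc e) t (π e) → position x t ≡ suc e → position x (suc (π e)) ≡ e
  crosses-left {e = e} t≤πe idle at-e+1 =
    trans (cong₂ swap (s-π e) (stays t≤πe idle (inj₂ ≤-refl) at-e+1)) (swap-right e)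

  π-injective-suc : ∀ e → π e ≢ π (suc e)
  π-injective-suc e πe≡πe+1 = <-irrefl (trans (sym (s-π e)) (trans (cong s πe≡πe+1) (s-π (suc e)))) (n<1+n e)

  passes-right⇒ascent : ∀ {x e} → x ≤ e → e < n → suc (suc e) ≤ position x n → π e < π (suc e)
  passes-right⇒ascent {x} {e} x≤e e<n far with <-cmp (π e) (π (suc e))
  ... | tri< πe<πe+1 _ _ = πe<πe+1
  ... | tri≈ _ πe≡πe+1 _ = contradiction πe≡πe+1 (π-injective-suc e)
  ... | tri> _ _ πe+1<πe = contradiction (≤-trans far at-most-e+1) (<-irrefl refl)
    where
    before : position x (π e) ≤ e
    before = stays-≤ z≤n (inj₂ ≤-refl) x≤e
    at-most-e+1 : position x n ≤ suc e
    at-most-e+1 = stays-≤ (π-< e<n) (inj₁ (m<n⇒m<1+n πe+1<πe))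
                    (≤-trans (swap-≤-suc (s (π e)) (position x (π e))) (s≤s before))

  passes-left⇒descent : ∀ {x e} → suc (suc e) ≤ x → suc e < n → position x n ≤ e → π (suc e) < π e
  passes-left⇒descent {x} {e} e+2≤x e+1<n near with <-cmp (π e) (π (suc e))
  ... | tri> _ _ πe+1<πe = πe+1<πe
  ... | tri≈ _ πe≡πe+1 _ = contradiction πe≡πe+1 (π-injective-suc e)
  ... | tri< πe<πe+1 _ _ = contradiction near (<⇒≱ at-least-e+1)
    where
    before : suc e < position x (π (suc e))
    before = stays-> z≤n (inj₂ ≤-refl) e+2≤x
    at-least-e+1 : e < position x n
    at-least-e+1 = stays-> (π-< e+1<n) (inj₁ (m<n⇒m<1+n πe<πe+1))
                     (≤-pred (≤-trans before (≤-suc-swap (s (π (suc e))) (position x (π (suc e))))))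

  ZigZag : Set
  ZigZag = ∀ i → suc i < n → Alternates (even i) (π i) (π (suc i))

  Cycle : Set
  Cycle = ∀ v → v ≤ n → suc (position v n) ≡ cyc (suc n) (suc v)

  module _ (zigzag : ZigZag) where

    ascent : ∀ {e} → even e ≡ true → π e < π (suc e)
    ascent {e} ev with <-≤-connex (suc e) n
    ... | inj₁ e+1<n = subst (λ b → Alternates b (π e) (π (suc e))) ev (zigzag e e+1<n)
    ... | inj₂ n≤e+1 = π-ascent-≥ n≤e+1

    descent : ∀ {e} → even e ≡ false → suc e < n → π (suc e) < π e
    descent {e} ev e+1<n = subst (λ b → Alternates b (π e) (π (suc e))) ev (zigzag e e+1<n)

    idle-left-before : ∀ {v} → even v ≡ true → v < n → IdleLeft v 0 (π v)
    idle-left-before {zero} _ _ = tt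
    idle-left-before {suc u} ev v<n = inj₂ (<⇒≤ (descent (even-suc⇒odd {u} ev) v<n))

    idle-left-after : ∀ {w} → even w ≡ true → Idle w (suc (π (suc w))) n
    idle-left-after ev = inj₁ (m<n⇒m<1+n (ascent ev))

    idle-right-after : ∀ {e} → even e ≡ false → Idle (suc e) (suc (π e)) n
    idle-right-after {e} ev with <-≤-connex (suc e) n
    ... | inj₁ e+1<n = inj₁ (m<n⇒m<1+n (descent ev e+1<n))
    ... | inj₂ n≤e+1 = idle-beyond n≤e+1 ≤-refl

    first-step-right : ∀ {v} → even v ≡ true → v < n → position v (suc (π v)) ≡ suc v
    first-step-right ev v<n = crosses-right z≤n (idle-left-before ev v<n) refl

    position-even-up : ∀ {v} → even v ≡ true → suc v < n → position v n ≡ suc (suc v)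
    position-even-up {v} ev v+1<n =
      stays (π-< v+1<n) (idle-right-after (even⇒odd-suc {v} ev)) (inj₁ ≤-refl)
        (crosses-right (ascent ev) (inj₁ ≤-refl) (first-step-right ev (<-trans (n<1+n v) v+1<n)))

    position-even-last : ∀ {v} → even v ≡ true → suc v ≡ n → position v n ≡ suc v
    position-even-last ev v+1≡n =
      stays (π-< (≤-reflexive v+1≡n)) (idle-beyond (≤-reflexive (sym v+1≡n)) ≤-refl) (inj₁ ≤-refl)
        (first-step-right ev (≤-reflexive v+1≡n))

    stops-after-left-step : ∀ {x w} → even w ≡ true → suc w < n →
      position x (suc (π (suc w))) ≡ suc w → position x n ≡ suc w
    stops-after-left-step ev w+1<n = stays (π-< w+1<n) (inj₁ ≤-refl) (idle-left-after ev)

    position-even-top : ∀ {u} → even (suc u) ≡ true → suc u ≡ n → position (suc u) n ≡ u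
    position-even-top {suc w} ev w+2≡n =
      stops-after-left-step ev (≤-reflexive w+2≡n)
        (crosses-left z≤n (idle-beyond (≤-reflexive (sym w+2≡n)) (<⇒≤ (π-< (≤-reflexive w+2≡n)))) refl)

    position-one : 0 < n → position 1 n ≡ 0
    position-one 0<n = stays (π-< 0<n) (inj₁ ≤-refl) tt (crosses-left z≤n (inj₂ (<⇒≤ (ascent refl))) refl)

    position-odd-down : ∀ {z} → even z ≡ true → suc (suc z) < n → position (suc (suc (suc z))) n ≡ suc z
    position-odd-down {z} ev z+2<n =
      stops-after-left-step ev (<-trans (n<1+n (suc z)) z+2<n)
        (crosses-left (descent (even⇒odd-suc {z} ev) z+2<n) (inj₁ ≤-refl)
          (crosses-left z≤n (inj₂ (<⇒≤ (ascent ev))) refl))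

    cycle-at-even : ∀ {v} → even v ≡ true → 0 < n → v ≤ n → suc (position v n) ≡ cyc (suc n) (suc v)
    cycle-at-even {v} ev 0<n v≤n with <-cmp (suc v) n
    ... | tri< v+1<n _ _ = trans (cong suc (position-even-up ev v+1<n)) (sym (cyc-even-up ev v+1<n))
    ... | tri≈ _ v+1≡n _ = trans (cong suc (position-even-last ev v+1≡n)) (sym (cyc-even-last ev v+1≡n))
    cycle-at-even {zero} ev 0<n v≤n | tri> _ _ n<1 = contradiction (≤-pred n<1) (<⇒≱ 0<n)
    cycle-at-even {suc u} ev 0<n v≤n | tri> _ _ n<v+1 =
      trans (cong suc (position-even-top ev v≡n)) (sym (cyc-even-top (even-suc⇒odd {u} ev) v≡n))
      where v≡n = ≤-antisym v≤n (≤-pred n<v+1)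

    cycle-at-odd : ∀ {v} → even v ≡ false → 0 < n → v ≤ n → suc (position v n) ≡ cyc (suc n) (suc v)
    cycle-at-odd {1} _ 0<n _ = cong suc (position-one 0<n)
    cycle-at-odd {suc (suc (suc z))} ev _ v≤n =
      trans (cong suc (position-odd-down (odd-suc⇒even {z} ev) v≤n)) (sym (cyc-odd-down {suc n} (odd-suc⇒even {z} ev)))

  zigzag⇒cycle : 0 < n → ZigZag → Cycle
  zigzag⇒cycle 0<n zigzag v v≤n with even v in ev
  ... | true = cycle-at-even zigzag ev 0<n v≤n
  ... | false = cycle-at-odd zigzag ev 0<n v≤n

  module _ (cycle : Cycle) where

    cycle-ascent : ∀ {i} → even i ≡ true → suc i < n → π i < π (suc i)
    cycle-ascent {i} ev i+1<n = passes-right⇒ascent ≤-refl i<n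
      (≤-reflexive (sym (suc-injective (trans (cycle i (<⇒≤ i<n)) (cyc-even-up ev i+1<n)))))
      where i<n = <-trans (n<1+n i) i+1<n

    cycle-descent : ∀ {i} → even i ≡ false → suc i < n → π (suc i) < π i
    cycle-descent {suc z} ev i+1<n = passes-left⇒descent ≤-refl i+1<n
      (≤-reflexive (suc-injective (trans (cycle _ i+1<n) (cyc-odd-down {suc n} (odd-suc⇒even {z} ev)))))

  cycle⇒zigzag : Cycle → ZigZag
  cycle⇒zigzag cycle i i+1<n with even i in ev
  ... | true = cycle-ascent cycle ev i+1<n
  ... | false = cycle-descent cycle ev i+1<n

  cycle⇔zigzag : 0 < n → Cycle ⇔ ZigZag
  cycle⇔zigzag 0<n = mk⇔ cycle⇒zigzag (zigzag⇒cycle 0<n)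

  product-position : ∀ x → toℕ (product σ x) ≡ position (toℕ x) n
  product-position = toℕ-foldl-edges (σ ⟨$⟩ʳ_) (λ i → i) s (extend-toℕ σ)

  oddEvenCycle⇔cycle : IsOddEvenCycle n (product σ) ⇔ Cycle
  oddEvenCycle⇔cycle = mk⇔
    (λ isCycle v v≤n → subst (λ w → suc (position w n) ≡ cyc (suc n) (suc w)) (toℕ-fromℕ< (s≤s v≤n))
                          (trans (cong suc (sym (product-position _))) (isCycle _)))
    (λ cycle x → trans (cong suc (product-position x)) (cycle (toℕ x) (≤-pred (toℕ<n x))))

  alternates-toℕ : ∀ (i j : Fin n) → toℕ j ≡ suc (toℕ i) →
    Alternates (even (toℕ i)) (toℕ (σ ⟨$⟩ˡ i)) (toℕ (σ ⟨$⟩ˡ j)) ≡ Alternates (even (toℕ i)) (π (toℕ i)) (π (suc (toℕ i)))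
  alternates-toℕ i j j≡i+1 =
    sym (cong₂ (Alternates (even (toℕ i))) (extend-toℕ (flip σ) i) (trans (cong π (sym j≡i+1)) (extend-toℕ (flip σ) j)))

  updown⇔zigzag : UpDown (σ ⟨$⟩ˡ_) ⇔ ZigZag
  updown⇔zigzag = mk⇔ updown⇒zigzag zigzag⇒updown
    where
    updown⇒zigzag : UpDown (σ ⟨$⟩ˡ_) → ZigZag
    updown⇒zigzag updown i i+1<n =
      subst (λ k → Alternates (even k) (π k) (π (suc k))) (toℕ-fromℕ< i<n)
        (subst id (alternates-toℕ _ _ j≡i+1) (updown (fromℕ< i<n) (fromℕ< i+1<n) j≡i+1))
      where
      i<n = <-trans (n<1+n i) i+1<n
      j≡i+1 = trans (toℕ-fromℕ< i+1<n) (cong suc (sym (toℕ-fromℕ< i<n)))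

    zigzag⇒updown : ZigZag → UpDown (σ ⟨$⟩ˡ_)
    zigzag⇒updown zigzag i j j≡i+1 =
      subst id (sym (alternates-toℕ i j j≡i+1)) (zigzag (toℕ i) (subst (_< n) j≡i+1 (toℕ<n j)))

theorem3p5 : (n : ℕ) → n ≥ 1 → (a : Permutation′ n) →
    IsOddEvenCycle n (product a) ⇔ UpDown (λ j → a ⟨$⟩ˡ j)
theorem3p5 n n≥1 a = ⇔.trans oddEvenCycle⇔cycle (⇔.trans (cycle⇔zigzag n≥1) (⇔.sym updown⇔zigzag))
  where open Schedule a
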